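{- Let $m,n>2$ and let $C$ be an $m\times n$ evolutionary stable configuration. Then $n$ is divisible by $3$, row $m$ of $C$ consists entirely of $1$'s, and row $m-1$ of $C$ is the string $101\,101\cdots101$ (the block $101$ repeated $n/3$ times), i.e. $C_{m-1,j}=0$ if $j\equiv 2\pmod 3$ and $C_{m-1,j}=1$ otherwise.
   Context: An $m\times n$ configuration is a $0$-$1$ matrix $C=(C_{i,j})$, $1\le i\le m$, $1\le j\le n$; row $1$ is the northernmost and row $m$ the southernmost, column $1$ the westernmost and column $n$ the easternmost; $C_{i,j}=1$ means lot $(i,j)$ is occupied by a house. A house at $(i,j)$ is blocked if $j>1$ and $C_{i,j-1}=1$, and $j<n$ and $C_{i,j+1}=1$, and $i<m$ and $C_{i+1,j}=1$. $C$ is permissible if no house is blocked; it is maximal if it is permissible and occupying any single empty lot yields a non-permissible configuration. A maximal configuration is resistant to predators if for every empty lot $(i,j)$, after setting $C_{i,j}=1$ the new house at $(i,j)$ is blocked; it is resistant to altruists if for every empty lot $(i,j)$, after setting $C_{i,j}=1$ some house at a position other than $(i,j)$ is blocked. An evolutionary stable configuration is a maximal configuration resistant to both predators and altruists. -}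

module Defs where

open import Data.Nat using (ℕ; zero; suc; _+_; _∸_; _<_; _%_; _≟_)
open import Data.Fin using (Fin; toℕ; fromℕ<)
open import Data.Bool using (Bool; true; false)
open import Data.Product using (_×_; ∃-syntax)
open import Relation.Binary.PropositionalEquality using (_≡_; _≢_)
open import Relation.Nullary using (¬_; yes; no)

-- Indices are 0-based: Fin m row index i stands for
-- paper row i+1 (row 0 = northernmost), Fin n column j for paper column j+1
-- (column 0 = westernmost). true = occupied (1), false = empty (0).
Config : ℕ → ℕ → Set
Config m n = Fin m → Fin n → Bool

Blocked : {m n : ℕ} → Config m n → Fin m → Fin n → Set
Blocked {m} {n} C i j =
  C i j ≡ true ×
  (∃[ j' ] (suc (toℕ j') ≡ toℕ j × C i j' ≡ true)) ×
  (∃[ j' ] (toℕ j' ≡ suc (toℕ j) × C i j' ≡ true)) ×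
  (∃[ i' ] (toℕ i' ≡ suc (toℕ i) × C i' j ≡ true))

Permissible : {m n : ℕ} → Config m n → Set
Permissible C = ∀ i j → ¬ Blocked C i j

set : {m n : ℕ} → Config m n → Fin m → Fin n → Config m n
set {m} {n} C i j i' j' with toℕ i' ≟ toℕ i | toℕ j' ≟ toℕ j
... | yes _ | yes _ = true
... | _ | _ = C i' j'

Maximal : {m n : ℕ} → Config m n → Set
Maximal C = Permissible C ×
  (∀ i j → C i j ≡ false → ¬ Permissible (set C i j))

ResistantToPredators : {m n : ℕ} → Config m n → Set
ResistantToPredators C = Maximal C ×
  (∀ i j → C i j ≡ false → Blocked (set C i j) i j)

ResistantToAltruists : {m n : ℕ} → Config m n → Set
ResistantToAltruists C = Maximal C ×
  (∀ i j → C i j ≡ false →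
     ∃[ i' ] ∃[ j' ] (¬ (toℕ i' ≡ toℕ i × toℕ j' ≡ toℕ j) × Blocked (set C i j) i' j'))

EvolutionaryStable : {m n : ℕ} → Config m n → Set
EvolutionaryStable C = Maximal C × ResistantToPredators C × ResistantToAltruists C

{-# OPTIONS --safe #-}
-- Read every row as a word over {0, 1} (0 = gap). Resistance to predators keeps the border
-- columns and the bottom row occupied, keeps gaps apart horizontally and vertically, and
-- permissibility forbids a house under the middle of three houses. For two stacked rows u
-- above w these local rules give, by telescoping a potential along the columns,
--   2 · gaps w + edgeGaps u ≤ 2 · gaps u + edgeGaps w,
-- where edgeGaps counts the gaps in the second and the second-to-last column: the density
-- of gaps cannot increase southwards. Since the top row has no row above it, resistance to
-- altruists leaves no isolated house in the second row, and an edge count shows that this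
-- row satisfies 3 (2 · gaps − edgeGaps) ≤ 2 (n − 3), the value attained by 101⋯101. The
-- bound therefore holds down to row m − 1, which lies on the full bottom row and so has no
-- three houses in a row. For rows without adjacent gaps
--   #111 + 3 · gaps = #010 + (n − 2) + edgeGaps,
-- so in row m − 1 the bound leaves no room for an isolated house and makes both lots next
-- to the edges gaps; the row is then forced to be 101⋯101, and its gap in column n − 1
-- gives 3 ∣ n.
module Submission where

open import Defs
open import Data.Nat using (ℕ; _<_; _+_; _%_)
open import Data.Nat.Divisibility using (_∣_)
open import Relation.Nullary using (¬_)
open import Data.Fin using (Fin; toℕ)
open import Data.Bool using (Bool; true; false)
open import Data.Product using (_×_)
open import Relation.Binary.PropositionalEquality using (_≡_)

open import Data.Nat using (zero; suc; _*_; _≤_; z≤n; s≤s)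
open import Data.Nat.Properties
open import Data.Nat.Tactic.RingSolver using (solve; solve-∀)
open import Data.Nat.Divisibility using (divides; ∣-refl; ∣m∣n⇒∣m+n)
open import Data.Fin using (fromℕ<)
open import Data.Fin.Properties using (toℕ<n; toℕ-fromℕ<; fromℕ<-toℕ)
open import Data.Bool using (_∧_; _∨_; not)
open import Data.Bool.Properties using (¬-not)
open import Data.Product using (_,_; proj₁; proj₂; ∃-syntax)
open import Data.Sum using (_⊎_; inj₁; inj₂; [_,_]′)
import Data.Sum as Sum
open import Data.Empty using (⊥; ⊥-elim)
open import Data.List using (_∷_; [])
open import Function using (_∘_)
open import Relation.Nullary using (yes; no)
open import Relation.Binary.PropositionalEquality
  using (_≢_; refl; sym; trans; cong; cong₂; subst; subst₂; module ≡-Reasoning)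

𝟙 : Bool → ℕ
𝟙 false = 0
𝟙 true  = 1

𝟙≤1 : ∀ b → 𝟙 b ≤ 1
𝟙≤1 false = z≤n
𝟙≤1 true  = ≤-refl

∨-true : ∀ {a b} → (a ≡ false → b ≡ true) → a ∨ b ≡ true
∨-true {true}  _      = refl
∨-true {false} b-true = b-true refl

∧₃-intro : ∀ {a b c} → a ≡ true → b ≡ true → c ≡ true → a ∧ b ∧ c ≡ true
∧₃-intro refl refl refl = refl

∧₃-elim : ∀ {a b c} → a ∧ b ∧ c ≡ true → a ≡ true × b ≡ true × c ≡ true
∧₃-elim {true} {true} {true} refl = refl , refl , refl

resolve : ∀ {A B : Set} → A ⊎ B → ¬ A → B
resolve (inj₁ a) ¬a = ⊥-elim (¬a a)
resolve (inj₂ b) _  = b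

2+n≢n : ∀ {n} → 2 + n ≢ n
2+n≢n {suc n} eq = 2+n≢n (suc-injective eq)

+-slack : ∀ {x y x′ y′ s t} → x + s ≤ y + t → x′ + t ≤ y′ + s → x + x′ ≤ y + y′
+-slack {x} {y} {x′} {y′} {s} {t} h h′ = +-cancelʳ-≤ (s + t) (x + x′) (y + y′) (begin
  x + x′ + (s + t)     ≡⟨ solve (x ∷ x′ ∷ s ∷ t ∷ []) ⟩
  (x + s) + (x′ + t)   ≤⟨ +-mono-≤ h h′ ⟩
  (y + t) + (y′ + s)   ≡⟨ solve (y ∷ y′ ∷ s ∷ t ∷ []) ⟩
  y + y′ + (s + t)     ∎)
  where open ≤-Reasoning

∑< : ℕ → (ℕ → ℕ) → ℕ
∑< zero    f = 0
∑< (suc K) f = ∑< K f + f K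

syntax ∑< K (λ k → e) = ∑[ k < K ] e

∑-+ : ∀ K (f g : ℕ → ℕ) → ∑[ k < K ] (f k + g k) ≡ ∑< K f + ∑< K g
∑-+ zero    f g = refl
∑-+ (suc K) f g = trans (cong (_+ (f K + g K)) (∑-+ K f g)) (interchange (∑< K f) (∑< K g) (f K) (g K))
  where
    interchange : ∀ a b c d → a + b + (c + d) ≡ a + c + (b + d)
    interchange = solve-∀

∑-* : ∀ K c (f : ℕ → ℕ) → ∑[ k < K ] (c * f k) ≡ c * ∑< K f
∑-* zero    c f = sym (*-zeroʳ c)
∑-* (suc K) c f = trans (cong (_+ c * f K) (∑-* K c f)) (sym (*-distribˡ-+ c (∑< K f) (f K)))

∑-1 : ∀ K → ∑[ k < K ] 1 ≡ K
∑-1 zero    = refl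
∑-1 (suc K) = trans (cong (_+ 1) (∑-1 K)) (+-comm K 1)

-- Telescoping with the signed potential p − q, kept in ℕ by moving q to the other side.
telescope-≤ : ∀ K (a b p q : ℕ → ℕ) →
  (∀ k → k < K → a k + p (suc k) + q k ≤ b k + q (suc k) + p k) →
  ∑< K a + q 0 + p K ≤ ∑< K b + p 0 + q K
telescope-≤ zero    a b p q step = ≤-reflexive (+-comm (q 0) (p 0))
telescope-≤ (suc K) a b p q step =
  subst₂ _≤_ (shuffle (∑< K a) (a K) (q 0) (p (suc K))) (shuffle (∑< K b) (b K) (p 0) (q (suc K)))
    (+-slack {x = ∑< K a + q 0} {y = ∑< K b + p 0} {x′ = a K + p (suc K)} {y′ = b K + q (suc K)}
             (telescope-≤ K a b p q (λ k k<K → step k (m<n⇒m<1+n k<K))) (step K ≤-refl))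
  where
    shuffle : ∀ w x y z → w + y + (x + z) ≡ w + x + y + z
    shuffle = solve-∀

telescope-≡ : ∀ K (a b p q : ℕ → ℕ) →
  (∀ k → k < K → a k + p (suc k) + q k ≡ b k + q (suc k) + p k) →
  ∑< K a + q 0 + p K ≡ ∑< K b + p 0 + q K
telescope-≡ K a b p q step = ≤-antisym
  (telescope-≤ K a b p q (λ k k<K → ≤-reflexive (step k k<K)))
  (telescope-≤ K b a q p (λ k k<K → ≤-reflexive (sym (step k k<K))))

count : (ℕ → Bool) → ℕ → ℕ
count p K = ∑[ k < K ] 𝟙 (p k)

count-none : ∀ {p} K → (∀ k → k < K → p k ≡ false) → count p K ≡ 0
count-none zero    _    = refl
count-none (suc K) none rewrite none K ≤-refl =
  trans (+-identityʳ _) (count-none K (λ k k<K → none k (m<n⇒m<1+n k<K)))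

count-pos : ∀ {p} K {k} → k < K → p k ≡ true → 1 ≤ count p K
count-pos {p} (suc K) k<1+K pk with m<1+n⇒m<n∨m≡n k<1+K
... | inj₁ k<K  = ≤-trans (count-pos K k<K pk) (m≤m+n (count p K) _)
... | inj₂ refl rewrite pk = m≤n+m 1 (count p K)

count≡0 : ∀ {p} K → count p K ≡ 0 → ∀ k → k < K → p k ≡ false
count≡0 K none k k<K = ¬-not λ pk → 1+n≰n (≤-trans (count-pos K k<K pk) (≤-reflexive none))

threeInARow : (ℕ → Bool) → ℕ → Bool
threeInARow r k = r k ∧ r (suc k) ∧ r (2 + k)

loneHouse : (ℕ → Bool) → ℕ → Bool
loneHouse r k = not (r k) ∧ r (suc k) ∧ not (r (2 + k))

flanked⇒notLone : ∀ a b c → (b ≡ true → a ≡ true ⊎ c ≡ true) → not a ∧ b ∧ not c ≡ false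
flanked⇒notLone true  _     _     _     = refl
flanked⇒notLone false false _     _     = refl
flanked⇒notLone false true  true  _     = refl
flanked⇒notLone false true  false flank with flank refl
... | inj₁ ()
... | inj₂ ()

-- A row occupies the positions 0 … K + 1; its windows are k, k + 1, k + 2 for k < K.
triples loneHouses innerGaps : (ℕ → Bool) → ℕ → ℕ
triples    r = count (threeInARow r)
loneHouses r = count (loneHouse r)
innerGaps  r = count (λ k → not (r (suc k)))

edgeGaps : (ℕ → Bool) → ℕ → ℕ
edgeGaps r K = 𝟙 (not (r 1)) + 𝟙 (not (r K))

edgeGaps≤2 : ∀ r K → edgeGaps r K ≤ 2
edgeGaps≤2 r K = +-mono-≤ (𝟙≤1 (not (r 1))) (𝟙≤1 (not (r K)))

edgeGaps≡2 : ∀ {r K} → edgeGaps r K ≡ 2 → r 1 ≡ false × r K ≡ false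
edgeGaps≡2 {r} {K} = both (r 1) (r K)
  where
    both : ∀ a b → 𝟙 (not a) + 𝟙 (not b) ≡ 2 → a ≡ false × b ≡ false
    both false false _ = refl , refl
    both false true  ()
    both true  false ()
    both true  true  ()

record SpacedRow (K : ℕ) (r : ℕ → Bool) : Set where
  field
    westEnd     : r 0 ≡ true
    eastEnd     : r (suc K) ≡ true
    noDoubleGap : ∀ k → k ≤ K → r k ∨ r (suc k) ≡ true

-- A window without adjacent gaps has [111] + #gaps = [010] + 1; adding 2 · [¬ b] to both sides
-- puts this in telescoping form.
window-identity : ∀ a b c → a ∨ b ≡ true → b ∨ c ≡ true →
  𝟙 (a ∧ b ∧ c) + 3 * 𝟙 (not b) + 𝟙 (not c) + 𝟙 (not a)
    ≡ 𝟙 (not a ∧ b ∧ not c) + 1 + 𝟙 (not b) + 𝟙 (not b)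
window-identity true  true  true  _ _ = refl
window-identity true  true  false _ _ = refl
window-identity true  false true  _ _ = refl
window-identity false true  true  _ _ = refl
window-identity false true  false _ _ = refl
window-identity _     false false _ ()
window-identity false false _     () _

triples+3*innerGaps : ∀ {K r} → SpacedRow K r →
  triples r K + 3 * innerGaps r K ≡ loneHouses r K + K + edgeGaps r K
triples+3*innerGaps {K} {r} row = begin
  triples r K + 3 * innerGaps r K
    ≡⟨ sym (trans (∑-+ K _ _) (cong (triples r K +_) (∑-* K 3 _))) ⟩
  ∑[ k < K ] (𝟙 (threeInARow r k) + 3 * 𝟙 (not (r (suc k))))
    ≡⟨ sym (+-vanish (cong (𝟙 ∘ not) westEnd) (cong (𝟙 ∘ not) eastEnd)) ⟩
  ∑[ k < K ] (𝟙 (threeInARow r k) + 3 * 𝟙 (not (r (suc k)))) + gap 0 + gap (suc K)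
    ≡⟨ telescope-≡ K _ _ (gap ∘ suc) gap window ⟩
  ∑[ k < K ] (𝟙 (loneHouse r k) + 1) + gap 1 + gap K
    ≡⟨ cong (λ x → x + gap 1 + gap K) (trans (∑-+ K _ _) (cong (loneHouses r K +_) (∑-1 K))) ⟩
  loneHouses r K + K + gap 1 + gap K
    ≡⟨ +-assoc (loneHouses r K + K) (gap 1) (gap K) ⟩
  loneHouses r K + K + edgeGaps r K ∎
  where
    open ≡-Reasoning
    open SpacedRow row
    gap : ℕ → ℕ
    gap k = 𝟙 (not (r k))
    +-vanish : ∀ {x a b} → a ≡ 0 → b ≡ 0 → x + a + b ≡ x
    +-vanish {x} refl refl = trans (+-identityʳ (x + 0)) (+-identityʳ x)
    window : ∀ k → k < K →
      𝟙 (threeInARow r k) + 3 * 𝟙 (not (r (suc k))) + gap (2 + k) + gap k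
        ≡ 𝟙 (loneHouse r k) + 1 + gap (suc k) + gap (suc k)
    window k k<K =
      window-identity (r k) (r (suc k)) (r (2 + k)) (noDoubleGap k (<⇒≤ k<K)) (noDoubleGap (suc k) k<K)

-- For a row of length n = K + 2 this says 3 (2 · gaps − edgeGaps) ≤ 2 (n − 3), with equality for 101⋯101.
FewGaps : ℕ → (ℕ → Bool) → Set
FewGaps K r = 6 * innerGaps r K + 2 ≤ 2 * K + 3 * edgeGaps r K

loneFree⇒fewGaps : ∀ {K r} → SpacedRow K r → loneHouses r K ≡ 0 →
  2 ≤ 2 * triples r K + edgeGaps r K → FewGaps K r
loneFree⇒fewGaps {K} {r} row noLone enough =
  arith (triples r K) (innerGaps r K) (loneHouses r K) (edgeGaps r K) (triples+3*innerGaps row) noLone enough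
  where
    arith : ∀ t z l e → t + 3 * z ≡ l + K + e → l ≡ 0 → 2 ≤ 2 * t + e → 6 * z + 2 ≤ 2 * K + 3 * e
    arith t z _ e identity refl two = begin
      6 * z + 2             ≤⟨ +-monoʳ-≤ (6 * z) two ⟩
      6 * z + (2 * t + e)   ≡⟨ solve (z ∷ t ∷ e ∷ []) ⟩
      2 * (t + 3 * z) + e   ≡⟨ cong (λ x → 2 * x + e) identity ⟩
      2 * (0 + K + e) + e   ≡⟨ solve (K ∷ e ∷ []) ⟩
      2 * K + 3 * e         ∎
      where open ≤-Reasoning

triple⇒2≤ : ∀ r K {k} e → k < K → threeInARow r k ≡ true → 2 ≤ 2 * triples r K + e
triple⇒2≤ r K e k<K three = ≤-trans (*-monoʳ-≤ 2 (count-pos K k<K three)) (m≤m+n (2 * triples r K) e)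

edgesFlanked⇒2≤ : ∀ {K r} → SpacedRow (suc K) r → (r 1 ≡ true → r 2 ≡ true) → (r (suc K) ≡ true → r K ≡ true) →
  2 ≤ 2 * triples r (suc K) + edgeGaps r (suc K)
edgesFlanked⇒2≤ {K} {r} row westFlank eastFlank = byEnds (r 1) (r (suc K)) refl refl
  where
    byEnds : ∀ a b → r 1 ≡ a → r (suc K) ≡ b → 2 ≤ 2 * triples r (suc K) + (𝟙 (not a) + 𝟙 (not b))
    byEnds true  _     second _    =
      triple⇒2≤ r (suc K) _ (s≤s z≤n) (∧₃-intro (SpacedRow.westEnd row) second (westFlank second))
    byEnds false false _      _    = m≤n+m 2 _
    byEnds false true  _      last =
      triple⇒2≤ r (suc K) _ ≤-refl (∧₃-intro (eastFlank last) last (SpacedRow.eastEnd row))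

tripleFree∧fewGaps⇒ : ∀ {K r} → SpacedRow K r → triples r K ≡ 0 → FewGaps K r →
  loneHouses r K ≡ 0 × edgeGaps r K ≡ 2
tripleFree∧fewGaps⇒ {K} {r} row noTriple few =
  arith (triples r K) (innerGaps r K) (loneHouses r K) (edgeGaps r K)
        (triples+3*innerGaps row) noTriple few (edgeGaps≤2 r K)
  where
    arith : ∀ t z l e → t + 3 * z ≡ l + K + e → t ≡ 0 → 6 * z + 2 ≤ 2 * K + 3 * e → e ≤ 2 → l ≡ 0 × e ≡ 2
    arith _ z l e identity refl bound e≤2 =
      n≤0⇒n≡0 (≤-trans (m≤m+n l (l + 0)) (+-cancelʳ-≤ 2 (2 * l) 0 (≤-trans 2l+2≤e e≤2))) ,
      ≤-antisym e≤2 (m+n≤o⇒n≤o (2 * l) 2l+2≤e)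
      where
        2l+2≤e : 2 * l + 2 ≤ e
        2l+2≤e = +-cancelʳ-≤ (2 * K + 2 * e) (2 * l + 2) e (begin
          2 * l + 2 + (2 * K + 2 * e)   ≡⟨ solve (l ∷ K ∷ e ∷ []) ⟩
          2 * (l + K + e) + 2           ≡⟨ cong (λ x → 2 * x + 2) identity ⟨
          2 * (0 + 3 * z) + 2           ≡⟨ solve (z ∷ []) ⟩
          6 * z + 2                     ≤⟨ bound ⟩
          2 * K + 3 * e                 ≡⟨ solve (K ∷ e ∷ []) ⟩
          e + (2 * K + 2 * e)           ∎)
          where open ≤-Reasoning

pattern101 : ℕ → Bool
pattern101 0                   = true
pattern101 1                   = false
pattern101 2                   = true
pattern101 (suc (suc (suc j))) = pattern101 j

pattern101-nand : ∀ j → pattern101 (2 + j) ≡ not (pattern101 j ∧ pattern101 (suc j))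
pattern101-nand 0                   = refl
pattern101-nand 1                   = refl
pattern101-nand 2                   = refl
pattern101-nand (suc (suc (suc j))) = pattern101-nand j

pattern101-% : ∀ j → (j % 3 ≡ 1 → pattern101 j ≡ false) × (¬ j % 3 ≡ 1 → pattern101 j ≡ true)
pattern101-% 0                   = (λ ()) , λ _ → refl
pattern101-% 1                   = (λ _ → refl) , λ j%3≢1 → ⊥-elim (j%3≢1 refl)
pattern101-% 2                   = (λ ()) , λ _ → refl
pattern101-% (suc (suc (suc j))) = pattern101-% j

pattern101-gap⇒3∣ : ∀ j → pattern101 j ≡ false → 3 ∣ 2 + j
pattern101-gap⇒3∣ 1                   _   = divides 1 refl
pattern101-gap⇒3∣ (suc (suc (suc j))) gap = ∣m∣n⇒∣m+n ∣-refl (pattern101-gap⇒3∣ j gap)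

nand-window : ∀ a b c → a ∨ b ≡ true → b ∨ c ≡ true → a ∧ b ∧ c ≡ false → not a ∧ b ∧ not c ≡ false →
  c ≡ not (a ∧ b)
nand-window true  true  false _ _ _ _ = refl
nand-window true  false true  _ _ _ _ = refl
nand-window false true  true  _ _ _ _ = refl
nand-window true  true  true  _ _ () _
nand-window false true  false _ _ _ ()
nand-window _     false false _ () _ _
nand-window false false _     () _ _ _

pattern101-forced : ∀ {K r} → SpacedRow K r → r 1 ≡ false → triples r K ≡ 0 → loneHouses r K ≡ 0 →
  ∀ j → j ≤ suc K → r j ≡ pattern101 j
pattern101-forced row gap₁ noTriple noLone 0 _ = SpacedRow.westEnd row
pattern101-forced row gap₁ noTriple noLone 1 _ = gap₁
pattern101-forced {K} {r} row gap₁ noTriple noLone (suc (suc j)) j+2≤K+1 = begin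
  r (2 + j)
    ≡⟨ nand-window (r j) (r (suc j)) (r (2 + j)) (noDoubleGap j (<⇒≤ j<K)) (noDoubleGap (suc j) j<K)
         (count≡0 K noTriple j j<K) (count≡0 K noLone j j<K) ⟩
  not (r j ∧ r (suc j))
    ≡⟨ cong₂ (λ a b → not (a ∧ b))
         (pattern101-forced row gap₁ noTriple noLone j (≤-trans (n≤1+n j) j+1≤K+1))
         (pattern101-forced row gap₁ noTriple noLone (suc j) j+1≤K+1) ⟩
  not (pattern101 j ∧ pattern101 (suc j))
    ≡⟨ pattern101-nand j ⟨
  pattern101 (2 + j) ∎
  where
    open ≡-Reasoning
    open SpacedRow row
    j<K : j < K
    j<K = ≤-pred j+2≤K+1
    j+1≤K+1 : suc j ≤ suc K
    j+1≤K+1 = ≤-trans (n≤1+n (suc j)) j+2≤K+1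

-- The house at position 1 + j of the row u is blocked, w being the row south of u.
record Jammed (u w : ℕ → Bool) (j : ℕ) : Set where
  constructor jammed
  field
    west  : u j ≡ true
    house : u (suc j) ≡ true
    east  : u (2 + j) ≡ true
    south : w (suc j) ≡ true

unjammed⇒noTriple : ∀ {u w k} → ¬ Jammed u w k → w (suc k) ≡ true → threeInARow u k ≡ false
unjammed⇒noTriple unjammed south = ¬-not λ three →
  let (west , house , east) = ∧₃-elim three in unjammed (jammed west house east south)

record Stacked (K : ℕ) (u w : ℕ → Bool) : Set where
  field
    upper        : SpacedRow K u
    lower        : SpacedRow K w
    noStackedGap : ∀ k → k ≤ suc K → u k ∨ w k ≡ true
    unjammed     : ∀ k → k < K → ¬ Jammed u w k

-- On consecutive columns (u, w), (u′, w′) of two stacked rows, 𝟙 (surplus u w w′) − 𝟙 (surplus w u u′)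
-- is a potential for the balance 2 · [w′ gap] − 2 · [u′ gap]. It solves the linear constraints
-- imposed by all admissible windows, and at both ends of the rows it reduces to the edge gaps.
surplus : Bool → Bool → Bool → Bool
surplus u w w′ = not u ∨ w ∧ not w′

surplus-west : ∀ {u w} w′ → u ≡ true → w ≡ true → surplus u w w′ ≡ not w′
surplus-west w′ refl refl = refl

surplus-east : ∀ u w {w′} → w′ ≡ true → surplus u w w′ ≡ not u
surplus-east true  true  refl = refl
surplus-east true  false refl = refl
surplus-east false _     refl = refl

surplus-window : ∀ u₀ w₀ u₁ w₁ u₂ w₂ → u₀ ∨ w₀ ≡ true → u₂ ∨ w₂ ≡ true → w₀ ∨ w₁ ≡ true →
  (u₀ ≡ true → u₁ ≡ true → u₂ ≡ true → w₁ ≡ true → ⊥) →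
  2 * 𝟙 (not w₁) + 𝟙 (surplus u₁ w₁ w₂) + 𝟙 (surplus w₀ u₀ u₁)
    ≤ 2 * 𝟙 (not u₁) + 𝟙 (surplus w₁ u₁ u₂) + 𝟙 (surplus u₀ w₀ w₁)
surplus-window true  true  false false _     _     _ _ _ _   = ≤-refl
surplus-window false true  false false _     _     _ _ _ _   = n≤1+n 3
surplus-window _     false false false _     _     _ _ () _
surplus-window _     _     false true  _     _     _ _ _ _   = s≤s (≤-trans (𝟙≤1 _) (s≤s z≤n))
surplus-window true  true  true  false _     _     _ _ _ _   = ≤-refl
surplus-window false true  true  false _     _     _ _ _ _   = ≤-refl
surplus-window _     false true  false _     _     _ _ () _
surplus-window false true  true  true  _     true  _ _ _ _   = z≤n
surplus-window false true  true  true  _     false _ _ _ _   = m≤n+m 1 _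
surplus-window false false true  true  _     _     () _ _ _
surplus-window true  _     true  true  true  _     _ _ _ unb = ⊥-elim (unb refl refl refl refl)
surplus-window true  true  true  true  false true  _ _ _ _   = z≤n
surplus-window true  true  true  true  false false _ _ _ _   = ≤-refl
surplus-window true  false true  true  false true  _ _ _ _   = ≤-refl
surplus-window true  false true  true  false false _ () _ _

gaps-descend : ∀ {K u w} → Stacked K u w → 2 * innerGaps w K + edgeGaps u K ≤ 2 * innerGaps u K + edgeGaps w K
gaps-descend {K} {u} {w} st = begin
  2 * innerGaps w K + edgeGaps u K
    ≡⟨ doubledGaps w u ⟩
  ∑[ k < K ] (2 * 𝟙 (not (w (suc k)))) + 𝟙 (not (u 1)) + 𝟙 (not (u K))
    ≡⟨ cong₂ (λ x y → _ + 𝟙 x + 𝟙 y) (surplus-west (u 1) (westEnd lower) (westEnd upper))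
                                     (surplus-east (u K) (w K) (eastEnd lower)) ⟨
  ∑[ k < K ] (2 * 𝟙 (not (w (suc k)))) + q 0 + p K
    ≤⟨ telescope-≤ K _ _ p q window ⟩
  ∑[ k < K ] (2 * 𝟙 (not (u (suc k)))) + p 0 + q K
    ≡⟨ cong₂ (λ x y → _ + 𝟙 x + 𝟙 y) (surplus-west (w 1) (westEnd upper) (westEnd lower))
                                     (surplus-east (w K) (u K) (eastEnd upper)) ⟩
  ∑[ k < K ] (2 * 𝟙 (not (u (suc k)))) + 𝟙 (not (w 1)) + 𝟙 (not (w K))
    ≡⟨ doubledGaps u w ⟨
  2 * innerGaps u K + edgeGaps w K ∎
  where
    open ≤-Reasoning
    open Stacked st
    open SpacedRow using (westEnd; eastEnd)
    p q : ℕ → ℕ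
    p k = 𝟙 (surplus (u k) (w k) (w (suc k)))
    q k = 𝟙 (surplus (w k) (u k) (u (suc k)))
    doubledGaps : ∀ r s → 2 * innerGaps r K + edgeGaps s K
                            ≡ ∑[ k < K ] (2 * 𝟙 (not (r (suc k)))) + 𝟙 (not (s 1)) + 𝟙 (not (s K))
    doubledGaps r s = trans (cong (_+ edgeGaps s K) (sym (∑-* K 2 _)))
                            (sym (+-assoc (∑[ k < K ] (2 * 𝟙 (not (r (suc k))))) _ _))
    window : ∀ k → k < K →
      2 * 𝟙 (not (w (suc k))) + p (suc k) + q k ≤ 2 * 𝟙 (not (u (suc k))) + q (suc k) + p k
    window k k<K = surplus-window (u k) (w k) (u (suc k)) (w (suc k)) (u (2 + k)) (w (2 + k))
      (noStackedGap k (≤-trans (<⇒≤ k<K) (n≤1+n K))) (noStackedGap (2 + k) (s≤s k<K))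
      (SpacedRow.noDoubleGap lower k (<⇒≤ k<K)) (λ a b c d → unjammed k k<K (jammed a b c d))

fewGaps-descend : ∀ {K u w} → Stacked K u w → FewGaps K u → FewGaps K w
fewGaps-descend {K} {u} {w} st =
  arith (innerGaps u K) (innerGaps w K) (edgeGaps u K) (edgeGaps w K) (gaps-descend st)
  where
    arith : ∀ zu zw eu ew → 2 * zw + eu ≤ 2 * zu + ew → 6 * zu + 2 ≤ 2 * K + 3 * eu → 6 * zw + 2 ≤ 2 * K + 3 * ew
    arith zu zw eu ew descend bound = +-cancelʳ-≤ (3 * eu) _ _ (begin
      6 * zw + 2 + 3 * eu       ≡⟨ solve (zw ∷ eu ∷ []) ⟩
      3 * (2 * zw + eu) + 2     ≤⟨ +-monoˡ-≤ 2 (*-monoʳ-≤ 3 descend) ⟩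
      3 * (2 * zu + ew) + 2     ≡⟨ solve (zu ∷ ew ∷ []) ⟩
      6 * zu + 2 + 3 * ew       ≤⟨ +-monoˡ-≤ (3 * ew) bound ⟩
      2 * K + 3 * eu + 3 * ew   ≡⟨ solve (K ∷ eu ∷ ew ∷ []) ⟩
      2 * K + 3 * ew + 3 * eu   ∎)
      where open ≤-Reasoning

-- Lots outside the grid count as empty.
lot : ∀ {m n} → Config m n → ℕ → ℕ → Bool
lot {m} {n} C i j with i <? m | j <? n
... | yes i<m | yes j<n = C (fromℕ< i<m) (fromℕ< j<n)
... | _       | _       = false

lot-fromℕ< : ∀ {m n i j} (C : Config m n) (i<m : i < m) (j<n : j < n) → lot C i j ≡ C (fromℕ< i<m) (fromℕ< j<n)
lot-fromℕ< {m} {n} {i} {j} C i<m j<n with i <? m | j <? n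
... | yes _   | yes _   = refl
... | yes _   | no j≮n  = ⊥-elim (j≮n j<n)
... | no i≮m  | _       = ⊥-elim (i≮m i<m)

lot-toℕ : ∀ {m n} (C : Config m n) a b → lot C (toℕ a) (toℕ b) ≡ C a b
lot-toℕ C a b = trans (lot-fromℕ< C (toℕ<n a) (toℕ<n b)) (cong₂ C (fromℕ<-toℕ a _) (fromℕ<-toℕ b _))

lot-at : ∀ {m n} (C : Config m n) {a b i j} → toℕ a ≡ i → toℕ b ≡ j → C a b ≡ true → lot C i j ≡ true
lot-at C {a} {b} refl refl occupied = trans (lot-toℕ C a b) occupied

lot-row : ∀ {m n} (C : Config m n) {i x} j → toℕ i ≡ x → lot C x (toℕ j) ≡ C i j
lot-row C {i} j refl = lot-toℕ C i j

lot-inside : ∀ {m n i j} (C : Config m n) → lot C i j ≡ true → i < m × j < n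
lot-inside {m} {n} {i} {j} C occupied with i <? m | j <? n
lot-inside C occupied  | yes i<m | yes j<n = i<m , j<n
lot-inside C ()        | yes _   | no _
lot-inside C ()        | no _    | _

set-occupied : ∀ {m n} (C : Config m n) a b a′ b′ → set C a b a′ b′ ≡ true →
  (toℕ a′ ≡ toℕ a × toℕ b′ ≡ toℕ b) ⊎ C a′ b′ ≡ true
set-occupied C a b a′ b′ occupied with toℕ a′ ≟ toℕ a | toℕ b′ ≟ toℕ b
... | yes a′≡a | yes b′≡b = inj₁ (a′≡a , b′≡b)
... | yes _    | no _     = inj₂ occupied
... | no _     | _        = inj₂ occupied

lot-set : ∀ {m n i j x y} (C : Config m n) (i<m : i < m) (j<n : j < n) →
  lot (set C (fromℕ< i<m) (fromℕ< j<n)) x y ≡ true → (x ≡ i × y ≡ j) ⊎ lot C x y ≡ true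
lot-set C i<m j<n occupied =
  Sum.map (λ (x≡i , y≡j) → toℕ-fromℕ<-≡ x<m i<m x≡i , toℕ-fromℕ<-≡ y<n j<n y≡j)
          (trans (lot-fromℕ< C x<m y<n))
          (set-occupied C _ _ _ _ (trans (sym (lot-fromℕ< (set C _ _) x<m y<n)) occupied))
  where
    x<m = proj₁ (lot-inside (set C _ _) occupied)
    y<n = proj₂ (lot-inside (set C _ _) occupied)
    toℕ-fromℕ<-≡ : ∀ {o x y} .(x<o : x < o) .(y<o : y < o) → toℕ (fromℕ< x<o) ≡ toℕ (fromℕ< y<o) → x ≡ y
    toℕ-fromℕ<-≡ x<o y<o eq = trans (sym (toℕ-fromℕ< x<o)) (trans eq (toℕ-fromℕ< y<o))

blocked⇒jammed : ∀ {m n} (C : Config m n) {a b i j} → toℕ a ≡ i → toℕ b ≡ j → Blocked C a b →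
  ∃[ j′ ] j ≡ suc j′ × Jammed (lot C i) (lot C (suc i)) j′
blocked⇒jammed C refl refl (house , (bw , 1+bw≡b , west) , (_ , be≡1+b , east) , (_ , bs≡1+a , south)) =
  toℕ bw , sym 1+bw≡b ,
  jammed (lot-at C refl refl west) (lot-at C refl (sym 1+bw≡b) house)
         (lot-at C refl (trans be≡1+b (cong suc (sym 1+bw≡b))) east) (lot-at C bs≡1+a (sym 1+bw≡b) south)

permissible⇒unjammed : ∀ {m n} {C : Config m n} → Permissible C → ∀ {i j} → ¬ Jammed (lot C i) (lot C (suc i)) j
permissible⇒unjammed {m} {n} {C} permissible (jammed west house east south) =
  permissible _ _
    ( at house
    , (_ , toℕ-suc (inside₂ west) (inside₂ house) , at west)
    , (_ , sym (toℕ-suc (inside₂ house) (inside₂ east)) , at east)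
    , (_ , sym (toℕ-suc (inside₁ house) (inside₁ south)) , at south))
  where
    inside₁ : ∀ {x y} → lot C x y ≡ true → x < m
    inside₁ occupied = proj₁ (lot-inside C occupied)
    inside₂ : ∀ {x y} → lot C x y ≡ true → y < n
    inside₂ occupied = proj₂ (lot-inside C occupied)
    at : ∀ {x y} (occupied : lot C x y ≡ true) → C (fromℕ< (inside₁ occupied)) (fromℕ< (inside₂ occupied)) ≡ true
    at occupied = trans (sym (lot-fromℕ< C (inside₁ occupied) (inside₂ occupied))) occupied
    toℕ-suc : ∀ {o x} .(x<o : x < o) .(x+1<o : suc x < o) → suc (toℕ (fromℕ< x<o)) ≡ toℕ (fromℕ< x+1<o)
    toℕ-suc x<o x+1<o = trans (cong suc (toℕ-fromℕ< x<o)) (sym (toℕ-fromℕ< x+1<o))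

gap-surrounded : ∀ {m n} {C : Config m n} → ResistantToPredators C → ∀ {i j} → i < m → j < n → lot C i j ≡ false →
  0 < j × lot C i (suc j) ≡ true × lot C (suc i) j ≡ true
gap-surrounded {C = C} (_ , predator) i<m j<n gap
  with blocked⇒jammed (set C (fromℕ< i<m) (fromℕ< j<n)) (toℕ-fromℕ< i<m) (toℕ-fromℕ< j<n)
         (predator (fromℕ< i<m) (fromℕ< j<n) (trans (sym (lot-fromℕ< C i<m j<n)) gap))
... | _ , refl , jammed _ _ east south =
  s≤s z≤n ,
  resolve (lot-set C i<m j<n east) (λ (_ , eq) → 1+n≢n eq) ,
  resolve (lot-set C i<m j<n south) (λ (eq , _) → 1+n≢n eq)

-- How occupying the gap (i, j) can block a house other than the new one.
data Completes (L : ℕ → ℕ → Bool) (i j : ℕ) : Set where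
  westNeighbour  : L i (suc j) ≡ true → L i (2 + j) ≡ true → L (suc i) (suc j) ≡ true → Completes L i j
  eastNeighbour  : ∀ {j′} → j ≡ 2 + j′ →
                   L i j′ ≡ true → L i (suc j′) ≡ true → L (suc i) (suc j′) ≡ true → Completes L i j
  southNeighbour : ∀ {i′ j′} → i ≡ suc i′ → j ≡ suc j′ →
                   L i′ j′ ≡ true → L i′ j ≡ true → L i′ (suc j) ≡ true → Completes L i j

newJam⇒completes : ∀ {L L′ : ℕ → ℕ → Bool} {i j x y} →
  (∀ {a b} → L′ a b ≡ true → (a ≡ i × b ≡ j) ⊎ L a b ≡ true) → ¬ (x ≡ i × suc y ≡ j) →
  ¬ Jammed (L x) (L (suc x)) y → Jammed (L′ x) (L′ (suc x)) y → Completes L i j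
newJam⇒completes old notNew unjammed (jammed west house east south)
  with old west | old house | old east | old south
... | _                  | inj₁ new    | _                  | _                  = ⊥-elim (notNew new)
... | inj₁ (refl , refl) | inj₂ house′ | east′              | south′             =
  westNeighbour house′ (resolve east′ (λ (_ , eq) → 2+n≢n eq)) (resolve south′ (λ (eq , _) → 1+n≢n eq))
... | inj₂ west′         | inj₂ house′ | inj₁ (refl , refl) | south′             =
  eastNeighbour refl west′ house′ (resolve south′ (λ (eq , _) → 1+n≢n eq))
... | inj₂ west′         | inj₂ house′ | inj₂ east′         | inj₁ (refl , refl) =
  southNeighbour refl refl west′ house′ east′
... | inj₂ west′         | inj₂ house′ | inj₂ east′         | inj₂ south′        =
  ⊥-elim (unjammed (jammed west′ house′ east′ south′))

gap-completes : ∀ {m n} {C : Config m n} → ResistantToAltruists C → ∀ {i j} → i < m → j < n → lot C i j ≡ false →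
  Completes (lot C) i j
gap-completes {C = C} ((permissible , _) , altruist) i<m j<n gap
  with altruist (fromℕ< i<m) (fromℕ< j<n) (trans (sym (lot-fromℕ< C i<m j<n)) gap)
... | a , b , notNew , blocked with blocked⇒jammed (set C (fromℕ< i<m) (fromℕ< j<n)) refl refl blocked
...   | y , b≡1+y , jam =
  newJam⇒completes (lot-set C i<m j<n)
    (λ (a≡i , 1+y≡j) → notNew (trans a≡i (sym (toℕ-fromℕ< i<m)) , trans b≡1+y (trans 1+y≡j (sym (toℕ-fromℕ< j<n)))))
    (permissible⇒unjammed permissible) jam

spacedRow : ∀ {m K} {C : Config m (2 + K)} → ResistantToPredators C → ∀ {i} → i < m → SpacedRow K (lot C i)
spacedRow {C = C} predators i<m = record
  { westEnd     = ¬-not λ gap → n≮0 (proj₁ (gap-surrounded predators i<m (s≤s z≤n) gap))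
  ; eastEnd     = ¬-not λ gap →
      n≮n _ (proj₂ (lot-inside C (proj₁ (proj₂ (gap-surrounded predators i<m ≤-refl gap)))))
  ; noDoubleGap = λ k k≤K → ∨-true λ gap →
      proj₁ (proj₂ (gap-surrounded predators i<m (s≤s (m≤n⇒m≤1+n k≤K)) gap))
  }

stacked : ∀ {m K} {C : Config m (2 + K)} → ResistantToPredators C → ∀ {i} → suc i < m →
  Stacked K (lot C i) (lot C (suc i))
stacked predators {i} i+1<m = record
  { upper        = spacedRow predators (≤-trans (n≤1+n (suc i)) i+1<m)
  ; lower        = spacedRow predators i+1<m
  ; noStackedGap = λ k k≤K+1 → ∨-true λ gap →
      proj₂ (proj₂ (gap-surrounded predators (≤-trans (n≤1+n (suc i)) i+1<m) (s≤s k≤K+1) gap))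
  ; unjammed     = λ _ _ → permissible⇒unjammed (proj₁ (proj₁ predators))
  }

bottomRow-full : ∀ {M n} {C : Config (suc M) n} → ResistantToPredators C → ∀ {j} → j < n → lot C M j ≡ true
bottomRow-full {C = C} predators j<n = ¬-not λ gap →
  n≮n _ (proj₁ (lot-inside C (proj₂ (proj₂ (gap-surrounded predators ≤-refl j<n gap)))))

-- The top row has no row above it, so a gap there can only complete a house beside it.
secondRow-flanked : ∀ {m n} {C : Config m n} → EvolutionaryStable C → ∀ {k} → 2 + k < n → lot C 1 (suc k) ≡ true →
  (0 < k × lot C 1 k ≡ true) ⊎ (3 + k < n × lot C 1 (2 + k) ≡ true)
secondRow-flanked {m} {n} {C} ((permissible , _) , predators , altruists) {k} k+2<n house =
  byAbove (lot C 0 (suc k)) refl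
  where
    Flanked : Set
    Flanked = (0 < k × lot C 1 k ≡ true) ⊎ (3 + k < n × lot C 1 (2 + k) ≡ true)
    0<m : 0 < m
    0<m = <⇒≤ (proj₁ (lot-inside C house))
    byNeighbour : Completes (lot C) 0 (suc k) → Flanked
    byNeighbour (westNeighbour _ far below)       = inj₂ (proj₂ (lot-inside C far) , below)
    byNeighbour (eastNeighbour 1+k≡2+j _ _ below) =
      inj₁ ( subst (0 <_) (sym (suc-injective 1+k≡2+j)) (s≤s z≤n)
           , subst (λ x → lot C 1 x ≡ true) (sym (suc-injective 1+k≡2+j)) below)
    byNeighbour (southNeighbour () _ _ _ _)
    bySides : ∀ a c → lot C 0 (suc k) ≡ true → lot C 0 k ≡ a → lot C 0 (2 + k) ≡ c → Flanked
    bySides false _     _     aboveWest _         =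
      let (0<k , _ , below) = gap-surrounded predators 0<m (≤-trans (n≤1+n (suc k)) (<⇒≤ k+2<n)) aboveWest
      in inj₁ (0<k , below)
    bySides true  false _     _         aboveEast =
      let (_ , far , below) = gap-surrounded predators 0<m k+2<n aboveEast
      in inj₂ (proj₂ (lot-inside C far) , below)
    bySides true  true  above aboveWest aboveEast =
      ⊥-elim (permissible⇒unjammed permissible (jammed aboveWest above aboveEast house))
    byAbove : ∀ b → lot C 0 (suc k) ≡ b → Flanked
    byAbove false above = byNeighbour (gap-completes altruists 0<m (<⇒≤ k+2<n) above)
    byAbove true  above = bySides (lot C 0 k) (lot C 0 (2 + k)) above refl refl

fewGaps-secondRow : ∀ {M K} {C : Config (2 + M) (3 + K)} → EvolutionaryStable C → FewGaps (suc K) (lot C 1)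
fewGaps-secondRow {K = K} {C} es@(_ , predators , _) =
  loneFree⇒fewGaps row
    (count-none _ λ k k<K → flanked⇒notLone (lot C 1 k) (lot C 1 (suc k)) (lot C 1 (2 + k)) λ house →
       Sum.map proj₂ proj₂ (secondRow-flanked es (s≤s (s≤s k<K)) house))
    (edgesFlanked⇒2≤ row
       (λ second → [ (λ ()) ∘ proj₁ , proj₂ ]′ (secondRow-flanked es (s≤s (s≤s (s≤s z≤n))) second))
       (λ last → [ proj₂ , (λ ()) ∘ n≮n _ ∘ proj₁ ]′ (secondRow-flanked es ≤-refl last)))
  where
    row : SpacedRow (suc K) (lot C 1)
    row = spacedRow predators (s≤s (s≤s z≤n))

fewGaps-below : ∀ {M K} {C : Config (2 + M) (3 + K)} → EvolutionaryStable C →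
  ∀ i → i ≤ M → FewGaps (suc K) (lot C (suc i))
fewGaps-below es zero _ = fewGaps-secondRow es
fewGaps-below es@(_ , predators , _) (suc i) i+1≤M =
  fewGaps-descend (stacked predators (s≤s (s≤s i+1≤M))) (fewGaps-below es i (≤-trans (n≤1+n i) i+1≤M))

penultimateRow : ∀ {M K} {C : Config (3 + M) (3 + K)} → EvolutionaryStable C →
  lot C (suc M) (suc K) ≡ false × (∀ j → j ≤ 2 + K → lot C (suc M) j ≡ pattern101 j)
penultimateRow {M} {K} {C} es@(_ , predators , _) =
  proj₂ endGaps , pattern101-forced row (proj₁ endGaps) tripleFree (proj₁ loneFree∧edges)
  where
    row : SpacedRow (suc K) (lot C (suc M))
    row = spacedRow predators (n≤1+n _)
    tripleFree : triples (lot C (suc M)) (suc K) ≡ 0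
    tripleFree = count-none (suc K) λ k k<K+1 →
      unjammed⇒noTriple (permissible⇒unjammed (proj₁ (proj₁ predators)) {i = suc M})
                        (bottomRow-full predators (s≤s (≤-trans k<K+1 (n≤1+n _))))
    loneFree∧edges : loneHouses (lot C (suc M)) (suc K) ≡ 0 × edgeGaps (lot C (suc M)) (suc K) ≡ 2
    loneFree∧edges = tripleFree∧fewGaps⇒ row tripleFree (fewGaps-below es M (n≤1+n M))
    endGaps : lot C (suc M) 1 ≡ false × lot C (suc M) (suc K) ≡ false
    endGaps = edgeGaps≡2 {lot C (suc M)} {suc K} (proj₂ loneFree∧edges)

proposition5p10 : (m n : ℕ) → 2 < m → 2 < n → (C : Config m n) → EvolutionaryStable C →
    3 ∣ n
    × (∀ (i : Fin m) (j : Fin n) → toℕ i + 1 ≡ m → C i j ≡ true)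
    × (∀ (i : Fin m) (j : Fin n) → toℕ i + 2 ≡ m →
         (toℕ j % 3 ≡ 1 → C i j ≡ false) × (¬ toℕ j % 3 ≡ 1 → C i j ≡ true))
proposition5p10 (suc (suc (suc M))) (suc (suc (suc K))) (s≤s (s≤s (s≤s _))) (s≤s (s≤s (s≤s _))) C es =
  pattern101-gap⇒3∣ (suc K) (trans (sym (follows101 (suc K) (n≤1+n _))) lastGap) , bottom , penultimate
  where
    lastGap : lot C (suc M) (suc K) ≡ false
    lastGap = proj₁ (penultimateRow es)
    follows101 : ∀ j → j ≤ 2 + K → lot C (suc M) j ≡ pattern101 j
    follows101 = proj₂ (penultimateRow es)
    bottom : ∀ i j → toℕ i + 1 ≡ 3 + M → C i j ≡ true
    bottom i j i+1≡m = trans (sym (lot-row C j (suc-injective (trans (+-comm 1 (toℕ i)) i+1≡m))))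
                             (bottomRow-full (proj₁ (proj₂ es)) (toℕ<n j))
    penultimate : ∀ i j → toℕ i + 2 ≡ 3 + M →
      (toℕ j % 3 ≡ 1 → C i j ≡ false) × (¬ toℕ j % 3 ≡ 1 → C i j ≡ true)
    penultimate i j i+2≡m =
      subst (λ b → (toℕ j % 3 ≡ 1 → b ≡ false) × (¬ toℕ j % 3 ≡ 1 → b ≡ true))
        (trans (sym (follows101 (toℕ j) (≤-pred (toℕ<n j))))
               (lot-row C j (suc-injective (suc-injective (trans (+-comm 2 (toℕ i)) i+2≡m)))))
        (pattern101-% (toℕ j))
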